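{- Let $G$ be a connected graph with positive edge lengths $\ell:E(G)\to\mathbb{R}_{>0}$, and let $H$ be a subgraph of $G$. Then $H$ is an isometric subgraph of $G$ if and only if \[ \forall x,y\in \partial H:\quad d_H(x,y)\le d_{H^c}(x,y). \]
   Context: The length of a walk is the sum of the lengths of its edges (with multiplicity); for a graph $F$ and vertices $x,y$, $d_F(x,y)$ is the minimum length of an $x$-to-$y$ path in $F$ ($+\infty$ if none exists). $H$ is isometric in $G$ if $d_G(x,y)=d_H(x,y)$ for all $x,y\in V(H)$. The boundary of $H$ is $\partial H=\{v\in V(H)\mid \exists\, uv\in E(G)\setminus E(H)\}$. The complement of $H$ is $H^c=(V(G),E(G)\setminus E(H))$, with the edge lengths inherited from $G$. -}

module Defs where

open import Level using (Level; suc; _⊔_; Lift)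
open import Data.Nat using (ℕ)
open import Data.Fin using (Fin)
open import Data.Bool using (Bool; true; false)
open import Data.List using (List; []; _∷_)
open import Data.List.Relation.Unary.Unique.Propositional using (Unique)
open import Data.Product using (_×_; ∃)
open import Relation.Binary.PropositionalEquality using (_≡_; _≢_)
open import Relation.Binary.Structures using (IsTotalOrder)
open import Relation.Nullary using (¬_)

-- Length values: a totally ordered commutative monoid (ℝ with +, ≤ is
-- an instance).  Edge lengths are required to be strictly positive.

record OrderedLengths (c ℓ : Level) : Set (suc (c ⊔ ℓ)) where
  infixl 6 _+_
  infix  4 _≤_
  field
    Carrier      : Set c
    0#           : Carrier
    _+_          : Carrier → Carrier → Carrier
    _≤_          : Carrier → Carrier → Set ℓ
    isTotalOrder : IsTotalOrder _≡_ _≤_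
    +-assoc      : ∀ a b c → (a + b) + c ≡ a + (b + c)
    +-comm       : ∀ a b → a + b ≡ b + a
    +-identityˡ  : ∀ a → 0# + a ≡ a
    +-mono-≤     : ∀ {a b c d} → a ≤ b → c ≤ d → a + c ≤ b + d

  _<_ : Carrier → Carrier → Set (c ⊔ ℓ)
  a < b = (a ≤ b) × (a ≢ b)

  data Carrier∞ : Set c where
    fin : Carrier → Carrier∞
    ∞   : Carrier∞

  data _≤∞_ : Carrier∞ → Carrier∞ → Set (c ⊔ ℓ) where
    fin≤fin : ∀ {a b} → a ≤ b → fin a ≤∞ fin b
    _≤∞∞    : ∀ x → x ≤∞ ∞

record WGraph {c ℓ} (L : OrderedLengths c ℓ) (n : ℕ) : Set (c ⊔ ℓ) where
  open OrderedLengths L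
  field
    adj       : Fin n → Fin n → Bool
    adj-sym   : ∀ u v → adj u v ≡ adj v u
    adj-irr   : ∀ v → adj v v ≡ false
    len       : Fin n → Fin n → Carrier       -- ℓ(uv), only meaningful on edges
    len-sym   : ∀ u v → len u v ≡ len v u
    len-pos   : ∀ u v → adj u v ≡ true → 0# < len u v

module _ {c ℓ} {L : OrderedLengths c ℓ} {n : ℕ} (G : WGraph L n) where
  open OrderedLengths L
  open WGraph G

  record Subgraph : Set where
    field
      vH      : Fin n → Bool
      eH      : Fin n → Fin n → Bool
      eH-sym  : ∀ u v → eH u v ≡ eH v u
      eH⊆E    : ∀ u v → eH u v ≡ true → adj u v ≡ true
      eH-endˡ : ∀ u v → eH u v ≡ true → vH u ≡ true

  -- Walks using only edges of an edge set F ⊆ E(G) (given as a Bool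
  -- predicate); F is G's own edge set, E(H), or E(G) ∖ E(H).
  data Walk (F : Fin n → Fin n → Bool) : Fin n → Fin n → Set where
    []  : ∀ {x} → Walk F x x
    _∷_ : ∀ {x z y} → F x z ≡ true → Walk F z y → Walk F x y

  vertices : ∀ {F x y} → Walk F x y → List (Fin n)
  vertices {x = x} []       = x ∷ []
  vertices {x = x} (_ ∷ w)  = x ∷ vertices w

  length : ∀ {F x y} → Walk F x y → Carrier
  length []                 = 0#
  length (_∷_ {x} {z} _ w)  = len x z + length w

  IsPath : ∀ {F x y} → Walk F x y → Set
  IsPath w = Unique (vertices w)

  Dist : (F : Fin n → Fin n → Bool) → Fin n → Fin n → Carrier∞ → Set (c ⊔ ℓ)
  Dist F x y (fin d) =
    ∃ (λ (p : Walk F x y) → IsPath p × length p ≡ d)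
    × (∀ (q : Walk F x y) → IsPath q → d ≤ length q)
  Dist F x y ∞ = Lift (c ⊔ ℓ) (∀ (q : Walk F x y) → ¬ IsPath q)

  -- edge sets of H and of its complement H^c = (V(G), E(G) ∖ E(H))
  E[_] : Subgraph → Fin n → Fin n → Bool
  E[ H ] = Subgraph.eH H

  E[_]ᶜ : Subgraph → Fin n → Fin n → Bool
  E[ H ]ᶜ u v with adj u v | Subgraph.eH H u v
  ... | true | false = true
  ... | _    | _     = false

  V[_] : Subgraph → Fin n → Set
  V[ H ] v = Subgraph.vH H v ≡ true

  Boundary : Subgraph → Fin n → Set
  Boundary H v = V[ H ] v × ∃ (λ u → E[ H ]ᶜ u v ≡ true)

  Connected : Set
  Connected = ∀ x y → Walk adj x y

  Isometric : Subgraph → Set (c ⊔ ℓ)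
  Isometric H = ∀ x y → V[ H ] x → V[ H ] y →
    ∀ dG dH → Dist adj x y dG → Dist E[ H ] x y dH → dG ≡ dH

{-# OPTIONS --safe #-}
-- If H is isometric, a path in Hᶜ is a path in G, so d_H = d_G ≤ d_Hᶜ.  Conversely, cut a
-- shortest G-path between vertices of H into maximal runs of edges outside H: each run starts
-- and ends at boundary vertices, so the condition replaces it by an H-walk that is no longer,
-- and d_H ≤ d_G follows.  Distances exist at all because a path visits each of the n vertices
-- at most once, so the paths form a finite list, which has a shortest element.
module Submission where

open import Defs
open import Function.Bundles using (_⇔_; mk⇔)

open import Axiom.UniquenessOfIdentityProofs using (module Decidable⇒UIP)
open import Data.Bool using (Bool; true; false)
import Data.Bool as Bool
open import Data.Empty using (⊥-elim)
open import Data.Fin using (Fin; zero; suc)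
import Data.Fin as Fin
open import Data.Fin.Properties using (injective⇒≤)
open import Data.List using (List; []; _∷_; _++_; map; concatMap; allFin; filter; lookup)
import Data.List as List
open import Data.List.Membership.Propositional using (_∈_; lose)
open import Data.List.Membership.Propositional.Properties
  using (∈-map⁺; ∈-++⁺ˡ; ∈-++⁺ʳ; ∈-allFin; ∈-concatMap⁺; ∈-filter⁺; ∈-lookup)
open import Data.List.Relation.Unary.All using (All; []; _∷_)
import Data.List.Relation.Unary.All as All
open import Data.List.Relation.Unary.All.Properties using (all-filter)
open import Data.List.Relation.Unary.All.Properties.Core using (¬Any⇒All¬)
open import Data.List.Relation.Unary.Any using (here; there)
open import Data.List.Relation.Unary.AllPairs using ([]; _∷_)
open import Data.List.Relation.Unary.Unique.Propositional using (Unique)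
open import Data.Nat using (ℕ; zero; suc; _<_; s≤s)
import Data.Nat as Nat
open import Data.Product using (_×_; ∃; Σ; _,_; proj₁)
open import Function using (_∘_; id; case_of_)
open import Function.Definitions using (Injective)
open import Level using (_⊔_; lift)
open import Relation.Binary.Bundles using (TotalOrder)
open import Relation.Binary.PropositionalEquality
  using (_≡_; refl; sym; trans; cong; subst; module ≡-Reasoning)
open import Relation.Binary.Structures using (IsTotalOrder)
open import Relation.Nullary using (yes; no; contradiction)

Unique⇒lookup-injective : ∀ {a} {A : Set a} {xs : List A} →
                          Unique xs → Injective _≡_ _≡_ (lookup xs)
Unique⇒lookup-injective (_ ∷ _) {zero} {zero} _ = refl
Unique⇒lookup-injective (x∉ ∷ _) {zero} {suc j} eq = contradiction eq       (All.lookup x∉ (∈-lookup j))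
Unique⇒lookup-injective (x∉ ∷ _) {suc i} {zero} eq = contradiction (sym eq) (All.lookup x∉ (∈-lookup i))
Unique⇒lookup-injective (_ ∷ u) {suc i} {suc j} eq = cong suc (Unique⇒lookup-injective u eq)

Unique⇒length≤ : ∀ {n} {xs : List (Fin n)} → Unique xs → List.length xs Nat.≤ n
Unique⇒length≤ u = injective⇒≤ (Unique⇒lookup-injective u)

module OrderedLengthsProperties {c ℓ} (L : OrderedLengths c ℓ) where
  open OrderedLengths L
  open IsTotalOrder isTotalOrder public using (antisym) renaming (refl to ≤-refl; trans to ≤-trans)

  totalOrder : TotalOrder c c ℓ
  totalOrder = record { isTotalOrder = isTotalOrder }

  +-identityʳ : ∀ a → a + 0# ≡ a
  +-identityʳ a = trans (+-comm a 0#) (+-identityˡ a)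

  +-monoʳ-≤ : ∀ a {b c} → b ≤ c → a + b ≤ a + c
  +-monoʳ-≤ a = +-mono-≤ ≤-refl

  ≤-+-nonnegˡ : ∀ {a b c} → 0# ≤ a → b ≤ c → b ≤ a + c
  ≤-+-nonnegˡ {b = b} 0≤a b≤c = subst (_≤ _) (+-identityˡ b) (+-mono-≤ 0≤a b≤c)

  ≤∞-trans : ∀ {a b d} → a ≤∞ b → b ≤∞ d → a ≤∞ d
  ≤∞-trans (fin≤fin p) (fin≤fin q) = fin≤fin (≤-trans p q)
  ≤∞-trans _           (_ ≤∞∞)     = _ ≤∞∞

  ≤∞-antisym : ∀ {a b} → a ≤∞ b → b ≤∞ a → a ≡ b
  ≤∞-antisym (fin≤fin p) (fin≤fin q) = cong fin (antisym p q)
  ≤∞-antisym (_ ≤∞∞)     (_ ≤∞∞)     = refl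

module WalkProperties {c ℓ} {L : OrderedLengths c ℓ} {n : ℕ} (G : WGraph L n) where
  open OrderedLengths L hiding (_<_)
  open OrderedLengthsProperties L
  open WGraph G
  open import Data.List.Membership.DecPropositional (Fin._≟_ {n}) using (_∈?_)
  open import Data.List.Relation.Unary.Unique.DecPropositional (Fin._≟_ {n}) using (unique?)

  EdgeSet : Set
  EdgeSet = Fin n → Fin n → Bool

  _⊆ᴱ_ : EdgeSet → EdgeSet → Set
  F ⊆ᴱ F′ = ∀ {u v} → F u v ≡ true → F′ u v ≡ true

  Shortens : EdgeSet → EdgeSet → Fin n → Fin n → Set ℓ
  Shortens F F′ x y = (w : Walk G F′ x y) → Σ (Walk G F x y) λ v → length G v ≤ length G w

  _++ᵂ_ : ∀ {F x y z} → Walk G F x y → Walk G F y z → Walk G F x z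
  []      ++ᵂ v = v
  (e ∷ w) ++ᵂ v = e ∷ (w ++ᵂ v)

  length-++ᵂ : ∀ {F x y z} (w : Walk G F x y) (v : Walk G F y z) →
               length G (w ++ᵂ v) ≡ length G w + length G v
  length-++ᵂ []                  v = sym (+-identityˡ _)
  length-++ᵂ (_∷_ {x} {z} _ w) v = trans (cong (len x z +_) (length-++ᵂ w v)) (sym (+-assoc _ _ _))

  mapᵂ : ∀ {F F′} → F ⊆ᴱ F′ → ∀ {x y} → Walk G F x y → Walk G F′ x y
  mapᵂ s []      = []
  mapᵂ s (e ∷ w) = s e ∷ mapᵂ s w

  length-mapᵂ : ∀ {F F′} (s : F ⊆ᴱ F′) {x y} (w : Walk G F x y) →
                length G (mapᵂ s w) ≡ length G w
  length-mapᵂ s []                = refl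
  length-mapᵂ s (_∷_ {x} {z} _ w) = cong (len x z +_) (length-mapᵂ s w)

  ⊆ᴱ⇒Shortens : ∀ {F F′} → F′ ⊆ᴱ F → ∀ {x y} → Shortens F F′ x y
  ⊆ᴱ⇒Shortens s w = mapᵂ s w , subst (length G (mapᵂ s w) ≤_) (length-mapᵂ s w) ≤-refl

  lastStep : ∀ {F x z y} → F x z ≡ true → Walk G F z y → ∃ λ t → F t y ≡ true
  lastStep e []       = _ , e
  lastStep _ (e ∷ w) = lastStep e w

  Dist-witness : ∀ {F x y d b} → Dist G F x y d → d ≤∞ fin b →
                 Σ (Walk G F x y) λ w → length G w ≤ b
  Dist-witness ((w , _ , refl) , _) (fin≤fin le) = w , le

  module _ {F : EdgeSet} (F⊆adj : F ⊆ᴱ adj) where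

    edge-nonneg : ∀ {u v} → F u v ≡ true → 0# ≤ len u v
    edge-nonneg {u} {v} e = proj₁ (len-pos u v (F⊆adj e))

    suffixFrom : ∀ {x z y} (w : Walk G F z y) → x ∈ vertices G w →
                 Σ (Walk G F x y) λ v → (IsPath G w → IsPath G v) × length G v ≤ length G w
    suffixFrom []      (here refl) = [] , id , ≤-refl
    suffixFrom (e ∷ w) (here refl) = e ∷ w , id , ≤-refl
    suffixFrom (e ∷ w) (there x∈w) =
      let v , path , le = suffixFrom w x∈w
      in  v , (λ { (_ ∷ u) → path u }) , ≤-+-nonnegˡ (edge-nonneg e) le

    walk⇒path : ∀ {x y} (w : Walk G F x y) →
                Σ (Walk G F x y) λ p → IsPath G p × length G p ≤ length G w
    walk⇒path []      = [] , [] ∷ [] , ≤-refl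
    walk⇒path {x} (_∷_ {z = z} e w) with walk⇒path w
    ... | p , p-path , le with x ∈? vertices G p
    ...   | no x∉p  = e ∷ p , ¬Any⇒All¬ _ x∉p ∷ p-path , +-monoʳ-≤ (len x z) le
    ...   | yes x∈p =
      let q , path , le′ = suffixFrom p x∈p
      in  q , path p-path , ≤-+-nonnegˡ (edge-nonneg e) (≤-trans le′ le)

    Dist≤walk : ∀ {x y d} → Dist G F x y d → (w : Walk G F x y) → d ≤∞ fin (length G w)
    Dist≤walk D w with walk⇒path w
    Dist≤walk {d = fin _} (_ , shortest) w | p , p-path , le = fin≤fin (≤-trans (shortest p p-path) le)
    Dist≤walk {d = ∞}     (lift no-path) w | p , p-path , _  = ⊥-elim (no-path p p-path)

    Shortens⇒Dist≤ : ∀ {F′ x y d d′} → Shortens F F′ x y →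
                     Dist G F x y d → Dist G F′ x y d′ → d ≤∞ d′
    Shortens⇒Dist≤ {d′ = ∞}     _       _ _                       = _ ≤∞∞
    Shortens⇒Dist≤ {d′ = fin _} shorten D ((w , _ , refl) , _) =
      let v , le = shorten w in ≤∞-trans (Dist≤walk D v) (fin≤fin le)

  edgeCount : ∀ {F x y} → Walk G F x y → ℕ
  edgeCount []      = 0
  edgeCount (_ ∷ w) = suc (edgeCount w)

  length-vertices : ∀ {F x y} (w : Walk G F x y) → List.length (vertices G w) ≡ suc (edgeCount w)
  length-vertices []      = refl
  length-vertices (_ ∷ w) = cong suc (length-vertices w)

  IsPath⇒edgeCount< : ∀ {F x y} {w : Walk G F x y} → IsPath G w → edgeCount w < n
  IsPath⇒edgeCount< {w = w} p = subst (Nat._≤ n) (length-vertices w) (Unique⇒length≤ p)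

  module Enumeration (F : EdgeSet) where

    emptyWalks : ∀ x y → List (Walk G F x y)
    emptyWalks x y with x Fin.≟ y
    ... | yes refl = [] ∷ []
    ... | no _     = []

    ∈-emptyWalks : ∀ {x} → [] ∈ emptyWalks x x
    ∈-emptyWalks {x} with x Fin.≟ x
    ... | yes refl = here refl
    ... | no x≢x   = contradiction refl x≢x

    prepend : ∀ {x z y} b → F x z ≡ b → List (Walk G F z y) → List (Walk G F x y)
    prepend true  e ws = map (e ∷_) ws
    prepend false _ _  = []

    ∈-prepend : ∀ {x z y b} (e′ : F x z ≡ b) (e : F x z ≡ true) {w : Walk G F z y} {ws} →
                w ∈ ws → (e ∷ w) ∈ prepend b e′ ws
    ∈-prepend {b = true}  e′ e w∈ws =
      subst (λ e″ → (e″ ∷ _) ∈ _) (Decidable⇒UIP.≡-irrelevant Bool._≟_ e′ e)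
            (∈-map⁺ (e′ ∷_) w∈ws)
    ∈-prepend {b = false} e′ e _ = contradiction (trans (sym e′) e) λ ()

    walksShorterThan : ℕ → ∀ x y → List (Walk G F x y)
    walksShorterThan zero    x y = []
    walksShorterThan (suc k) x y =
      emptyWalks x y ++ concatMap (λ z → prepend (F x z) refl (walksShorterThan k z y)) (allFin n)

    ∈-walksShorterThan : ∀ {k x y} (w : Walk G F x y) → edgeCount w < k →
                         w ∈ walksShorterThan k x y
    ∈-walksShorterThan {suc k} []                _        = ∈-++⁺ˡ ∈-emptyWalks
    ∈-walksShorterThan {suc k} (_∷_ {z = z} e w) (s≤s lt) =
      ∈-++⁺ʳ (emptyWalks _ _)
        (∈-concatMap⁺ _ (lose (∈-allFin z) (∈-prepend refl e (∈-walksShorterThan w lt))))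

  Dist-from-candidates : ∀ {F x y} (ps : List (Walk G F x y)) → All (IsPath G) ps →
                         (∀ q → IsPath G q → q ∈ ps) → ∃ (Dist G F x y)
  Dist-from-candidates []       _     complete = ∞ , lift λ q q-path → case complete q q-path of λ ()
  Dist-from-candidates (p ∷ ps) paths complete =
    fin (length G m) , (m , argmin-all (length G) (All.head paths) paths , refl) ,
    λ q q-path → All.lookup (f[argmin]≤f[xs] p (p ∷ ps)) (complete q q-path)
    where
      open import Data.List.Extrema totalOrder using (argmin; argmin-all; f[argmin]≤f[xs])
      m = argmin (length G) p (p ∷ ps)

  Dist-exists : ∀ F x y → ∃ (Dist G F x y)
  Dist-exists F x y =
    Dist-from-candidates (filter path? walks) (all-filter path? walks)
      λ q q-path → ∈-filter⁺ path? (∈-walksShorterThan q (IsPath⇒edgeCount< q-path)) q-path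
    where
      open Enumeration F
      path? = unique? ∘ vertices G
      walks = walksShorterThan n x y

module IsometryCriterion {c ℓ} {L : OrderedLengths c ℓ} {n : ℕ}
                         (G : WGraph L n) (H : Subgraph G) where
  open OrderedLengths L hiding (_<_)
  open OrderedLengthsProperties L
  open WGraph G
  open Subgraph H
  open WalkProperties G

  ∈Eᶜ⁻ : ∀ {u v} → E[_]ᶜ G H u v ≡ true → adj u v ≡ true × eH u v ≡ false
  ∈Eᶜ⁻ {u} {v} with adj u v | eH u v
  ... | true  | false = λ _ → refl , refl
  ... | true  | true  = λ ()
  ... | false | _     = λ ()

  ∈Eᶜ⁺ : ∀ {u v} → adj u v ≡ true → eH u v ≡ false → E[_]ᶜ G H u v ≡ true
  ∈Eᶜ⁺ uv∈E uv∉H rewrite uv∈E | uv∉H = refl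

  Eᶜ⊆adj : E[_]ᶜ G H ⊆ᴱ adj
  Eᶜ⊆adj = proj₁ ∘ ∈Eᶜ⁻

  Eᶜ-sym : ∀ {u v} → E[_]ᶜ G H u v ≡ true → E[_]ᶜ G H v u ≡ true
  Eᶜ-sym {u} {v} uv∈Eᶜ =
    let uv∈E , uv∉H = ∈Eᶜ⁻ uv∈Eᶜ
    in  ∈Eᶜ⁺ (trans (adj-sym v u) uv∈E) (trans (eH-sym v u) uv∉H)

  eH-endʳ : ∀ {u v} → eH u v ≡ true → V[_] G H v
  eH-endʳ {u} {v} uv∈H = eH-endˡ v u (trans (eH-sym v u) uv∈H)

  BoundaryCondition : Set (c ⊔ ℓ)
  BoundaryCondition = ∀ x y → Boundary G H x → Boundary G H y →
    ∀ dH dHc → Dist G (E[_] G H) x y dH → Dist G (E[_]ᶜ G H) x y dHc → dH ≤∞ dHc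

  isometric⇒boundaryCondition : Isometric G H → BoundaryCondition
  isometric⇒boundaryCondition isometric x y (x∈H , _) (y∈H , _) dH dHc DH DHc =
    let dG , DG = Dist-exists adj x y
    in  subst (_≤∞ dHc) (isometric x y x∈H y∈H dG dH DG DH)
              (Shortens⇒Dist≤ id (⊆ᴱ⇒Shortens Eᶜ⊆adj) DG DHc)

  module _ (condition : BoundaryCondition) where

    bridgeBoundary : ∀ {x y} → Boundary G H x → Boundary G H y →
                     Shortens (E[_] G H) (E[_]ᶜ G H) x y
    bridgeBoundary {x} {y} ∂x ∂y u =
      let dH  , DH  = Dist-exists (E[_] G H) x y
          dHc , DHc = Dist-exists (E[_]ᶜ G H) x y
      in  Dist-witness DH
            (≤∞-trans (condition x y ∂x ∂y dH dHc DH DHc) (Dist≤walk Eᶜ⊆adj DHc u))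

    -- A nonempty walk in Hᶜ between vertices of H leaves and re-enters H, so its ends lie in ∂H.
    bridge : ∀ {x y} → V[_] G H x → V[_] G H y → Shortens (E[_] G H) (E[_]ᶜ G H) x y
    bridge _   _   []            = [] , ≤-refl
    bridge x∈H y∈H u@(e ∷ rest) = bridgeBoundary (x∈H , _ , Eᶜ-sym e) (y∈H , lastStep e rest) u

    -- u is the current run of edges outside H; it is bridged as soon as w returns to H.
    reroute : ∀ {x z y} → V[_] G H x → (u : Walk G (E[_]ᶜ G H) x z) →
              (w : Walk G adj z y) → V[_] G H y →
              Σ (Walk G (E[_] G H) x y) λ v → length G v ≤ length G u + length G w
    reroute x∈H u [] y∈H =
      let v , le = bridge x∈H y∈H u
      in  v , subst (length G v ≤_) (sym (+-identityʳ _)) le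
    reroute {z = z} x∈H u (_∷_ {z = t} e w) y∈H with eH z t in zt∈H
    ... | true =
      let v₁ , le₁ = bridge x∈H (eH-endˡ z t zt∈H) u
          v₂ , le₂ = reroute (eH-endʳ zt∈H) [] w y∈H
      in  v₁ ++ᵂ (zt∈H ∷ v₂) ,
          subst (_≤ _) (sym (length-++ᵂ v₁ (zt∈H ∷ v₂)))
            (+-mono-≤ le₁ (+-monoʳ-≤ (len z t) (subst (length G v₂ ≤_) (+-identityˡ _) le₂)))
    ... | false =
      let zt∈Eᶜ = ∈Eᶜ⁺ e zt∈H
          v , le = reroute x∈H (u ++ᵂ (zt∈Eᶜ ∷ [])) w y∈H
      in  v , subst (length G v ≤_) (regroup zt∈Eᶜ) le
      where
        regroup : (zt∈Eᶜ : E[_]ᶜ G H z t ≡ true) →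
                  length G (u ++ᵂ (zt∈Eᶜ ∷ [])) + length G w ≡
                  length G u + (len z t + length G w)
        regroup zt∈Eᶜ = begin
          length G (u ++ᵂ (zt∈Eᶜ ∷ [])) + length G w
            ≡⟨ cong (_+ length G w) (length-++ᵂ u (zt∈Eᶜ ∷ [])) ⟩
          (length G u + (len z t + 0#)) + length G w
            ≡⟨ cong (λ a → (length G u + a) + length G w) (+-identityʳ _) ⟩
          (length G u + len z t) + length G w
            ≡⟨ +-assoc _ _ _ ⟩
          length G u + (len z t + length G w)
            ∎
          where open ≡-Reasoning

    boundaryCondition⇒isometric : Isometric G H
    boundaryCondition⇒isometric x y x∈H y∈H dG dH DG DH =
      ≤∞-antisym (Shortens⇒Dist≤ id (⊆ᴱ⇒Shortens (eH⊆E _ _)) DG DH)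
                 (Shortens⇒Dist≤ (eH⊆E _ _) rerouteWalk DH DG)
      where
        rerouteWalk : Shortens (E[_] G H) adj x y
        rerouteWalk w =
          let v , le = reroute x∈H [] w y∈H
          in  v , subst (length G v ≤_) (+-identityˡ _) le

lemma1 : ∀ {c ℓ} (L : OrderedLengths c ℓ) (n : ℕ) (G : WGraph L n) →
    Connected G → (H : Subgraph G) →
    Isometric G H ⇔
      (∀ x y → Boundary G H x → Boundary G H y →
        ∀ dH dHc → Dist G (E[_] G H) x y dH → Dist G (E[_]ᶜ G H) x y dHc →
          OrderedLengths._≤∞_ L dH dHc)
lemma1 L n G _ H = mk⇔ isometric⇒boundaryCondition boundaryCondition⇒isometric
  where open IsometryCriterion G H
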